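{- Let $p \geqslant 2$ be an integer. The standard model $(\mathbb N, S, +, 0, V_p)$ satisfies every axiom of the theory $\mathsf{T_{BA}}_p$; equivalently, $\mathsf{BA}_p \vDash \mathsf{T_{BA}}_p$.
   Context: Fix an integer $p \geqslant 2$. The language consists of a constant $0$, a unary function symbol $S$, a binary function symbol $+$ and a unary function symbol $V_p$. In the standard model $(\mathbb N, S, +, 0, V_p)$, $S(n)=n+1$, $+$ is addition, $V_p(0)=0$ and, for $n>0$, $V_p(n)=p^k$ where $p^k \mid n$ and $p^{k+1}\nmid n$. $\mathsf{BA}_p$ denotes the complete first-order theory of this standard model. For $n\in\mathbb N$, $\underline n$ denotes the numeral $S^n(0)$; for a positive integer $n$ and a term $t$, $n t$ denotes the term $(\dots((t+t)+t)\dots)$ with $n$ occurrences of $t$. Iterated exponentials are defined by $2^k_0=k$, $2^k_{m+1}=2^{2^k_m}$. For a formula $\varphi$, $|\varphi|$ is its length (number of symbols). $x \leqslant y$ abbreviates $\exists z\,(x+z=y)$ for a fresh variable $z$, and $\exists x \leqslant t\, \varphi$ abbreviates $\exists x\,(x\leqslant t \wedge \varphi)$. The theory $\mathsf{T_{BA}}_p$ consists of the (universal closures of the) axioms: (S0) $Sx=Sy\to x=y$; (S1) $0\ne Sx$; (S2) $x=0\vee\exists y\,(x=Sy)$; (A0) $x+0=x$; (A1) $x+Sy=S(x+y)$; (V0) $V_p(0)=0$; (V1) $V_p(\underline 1)=\underline 1$; (V2) $V_p(p x)=p V_p(x)$; (V3) $\bigwedge_{i=1}^{p-1} V_p(p x+\underline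 i)=\underline 1$; and, for each formula $\varphi(x)$ with exactly one free variable, (Bound$_\varphi$) $\exists x\,\varphi(x)\to\exists x\leqslant \underline{n_\varphi}\,\varphi(x)$, where $n_\varphi=p^{2^3_{|\varphi|}}$. -}

module Defs where

open import Data.Nat using (ℕ; zero; suc; _+_; _*_; _^_; _≤_; _⊔_; NonZero)
open import Data.Nat.Divisibility using (_∣_)
open import Data.Product using (Σ; _×_; _,_; ∃)
open import Data.Sum using (_⊎_)
open import Data.Empty using (⊥)
open import Data.Unit using (⊤)
open import Relation.Nullary using (¬_)
open import Relation.Binary.PropositionalEquality using (_≡_; _≢_)

data Term : Set where
  var  : ℕ → Term
  𝟎    : Term
  S    : Term → Term
  _⊕_  : Term → Term → Term
  V    : Term → Term

infixl 6 _⊕_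

data Formula : Set where
  _≐_  : Term → Term → Formula
  ¬'_  : Formula → Formula
  _∧'_ : Formula → Formula → Formula
  _∨'_ : Formula → Formula → Formula
  _⇒_  : Formula → Formula → Formula
  ∃'   : ℕ → Formula → Formula
  ∀'   : ℕ → Formula → Formula

infix 4 _≐_
infixr 3 _∧'_
infixr 2 _∨'_
infixr 1 _⇒_

num : ℕ → Term
num zero    = 𝟎
num (suc n) = S (num n)

times : ℕ → Term → Term
times zero          t = 𝟎
times (suc zero)    t = t
times (suc (suc n)) t = times (suc n) t ⊕ t

-- Length |φ| = number of symbol occurrences (Polish notation, no
-- parentheses): every variable, constant, function symbol, '=',
-- connective and quantifier counts 1; '∃x' / '∀x' count 2.

lenT : Term → ℕ
lenT (var _) = 1
lenT 𝟎       = 1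
lenT (S t)   = suc (lenT t)
lenT (t ⊕ s) = suc (lenT t + lenT s)
lenT (V t)   = suc (lenT t)

len : Formula → ℕ
len (t ≐ s)  = suc (lenT t + lenT s)
len (¬' φ)   = suc (len φ)
len (φ ∧' ψ) = suc (len φ + len ψ)
len (φ ∨' ψ) = suc (len φ + len ψ)
len (φ ⇒ ψ)  = suc (len φ + len ψ)
len (∃' _ φ) = 2 + len φ
len (∀' _ φ) = 2 + len φ

OccT : ℕ → Term → Set
OccT y (var x) = y ≡ x
OccT y 𝟎       = ⊥
OccT y (S t)   = OccT y t
OccT y (t ⊕ s) = OccT y t ⊎ OccT y s
OccT y (V t)   = OccT y t

Free : ℕ → Formula → Set
Free y (t ≐ s)  = OccT y t ⊎ OccT y s
Free y (¬' φ)   = Free y φ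
Free y (φ ∧' ψ) = Free y φ ⊎ Free y ψ
Free y (φ ∨' ψ) = Free y φ ⊎ Free y ψ
Free y (φ ⇒ ψ)  = Free y φ ⊎ Free y ψ
Free y (∃' x φ) = y ≢ x × Free y φ
Free y (∀' x φ) = y ≢ x × Free y φ

ExactlyFree : ℕ → Formula → Set
ExactlyFree x φ = Free x φ × (∀ y → Free y φ → y ≡ x)

maxVarT : Term → ℕ
maxVarT (var x) = x
maxVarT 𝟎       = 0
maxVarT (S t)   = maxVarT t
maxVarT (t ⊕ s) = maxVarT t ⊔ maxVarT s
maxVarT (V t)   = maxVarT t

maxVar : Formula → ℕ
maxVar (t ≐ s)  = maxVarT t ⊔ maxVarT s
maxVar (¬' φ)   = maxVar φ
maxVar (φ ∧' ψ) = maxVar φ ⊔ maxVar ψ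
maxVar (φ ∨' ψ) = maxVar φ ⊔ maxVar ψ
maxVar (φ ⇒ ψ)  = maxVar φ ⊔ maxVar ψ
maxVar (∃' x φ) = x ⊔ maxVar φ
maxVar (∀' x φ) = x ⊔ maxVar φ

boundedEx : ℕ → Term → Formula → Formula
boundedEx x t φ = ∃' x ((∃' z (var x ⊕ var z ≐ t)) ∧' φ)
  where z = suc (x ⊔ maxVarT t ⊔ maxVar φ)

tower : ℕ → ℕ → ℕ
tower k zero    = k
tower k (suc m) = 2 ^ tower k m

nBound : ℕ → Formula → ℕ
nBound p φ = p ^ tower 3 (len φ)

-- ⋀_{i=1}^{k+1} f i
bigAnd : ℕ → (ℕ → Formula) → Formula
bigAnd zero    f = f 1
bigAnd (suc k) f = bigAnd k f ∧' f (suc (suc k))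

module _ where
  private
    x y : Term
    x = var 0
    y = var 1

  data Axiom (p : ℕ) : Formula → Set where
    S0 : Axiom p (∀' 0 (∀' 1 (S x ≐ S y ⇒ x ≐ y)))
    S1 : Axiom p (∀' 0 (¬' (𝟎 ≐ S x)))
    S2 : Axiom p (∀' 0 (x ≐ 𝟎 ∨' ∃' 1 (x ≐ S y)))
    A0 : Axiom p (∀' 0 (x ⊕ 𝟎 ≐ x))
    A1 : Axiom p (∀' 0 (∀' 1 (x ⊕ S y ≐ S (x ⊕ y))))
    V0 : Axiom p (V 𝟎 ≐ 𝟎)
    V1 : Axiom p (V (num 1) ≐ num 1)
    V2 : Axiom p (∀' 0 (V (times p x) ≐ times p (V x)))
    V3 : Axiom p (∀' 0 (bigAnd (p Data.Nat.∸ 2) (λ i → V (times p x ⊕ num i) ≐ num 1)))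
    Bound : (φ : Formula) (v : ℕ) → ExactlyFree v φ →
            Axiom p (∃' v φ ⇒ boundedEx v (num (nBound p φ)) φ)

IsVp : ℕ → (ℕ → ℕ) → Set
IsVp p v = (v 0 ≡ 0) ×
           (∀ n → Σ ℕ λ k → (v (suc n) ≡ p ^ k) × (p ^ k ∣ suc n) × ¬ (p ^ suc k ∣ suc n))

Assignment : Set
Assignment = ℕ → ℕ

_[_↦_] : Assignment → ℕ → ℕ → Assignment
(ρ [ x ↦ a ]) y with Data.Nat._≟_ y x
... | Relation.Nullary.yes _ = a
... | Relation.Nullary.no  _ = ρ y

evalT : (ℕ → ℕ) → Assignment → Term → ℕ
evalT v ρ (var x) = ρ x
evalT v ρ 𝟎       = 0
evalT v ρ (S t)   = suc (evalT v ρ t)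
evalT v ρ (t ⊕ s) = evalT v ρ t + evalT v ρ s
evalT v ρ (V t)   = v (evalT v ρ t)

Sat : (ℕ → ℕ) → Assignment → Formula → Set
Sat v ρ (t ≐ s)  = evalT v ρ t ≡ evalT v ρ s
Sat v ρ (¬' φ)   = ¬ Sat v ρ φ
Sat v ρ (φ ∧' ψ) = Sat v ρ φ × Sat v ρ ψ
Sat v ρ (φ ∨' ψ) = Sat v ρ φ ⊎ Sat v ρ ψ
Sat v ρ (φ ⇒ ψ)  = Sat v ρ φ → Sat v ρ ψ
Sat v ρ (∃' x φ) = Σ ℕ λ a → Sat v (ρ [ x ↦ a ]) φ
Sat v ρ (∀' x φ) = (a : ℕ) → Sat v (ρ [ x ↦ a ]) φ

{-# OPTIONS --safe #-}
module Submission where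

-- For Bound_φ, compile φ
-- into a deterministic automaton that reads all variables in parallel, in base
-- p, least significant digit first: terms become carry-propagating transducers
-- (V_p only needs to remember whether a nonzero digit has been read),
-- connectives become product automata and quantifiers a subset construction,
-- so the automaton has N ≤ 2^1_{|φ|} states.  If φ(a) holds and a ≥ p^N, two
-- of the states reached after reading the first 0, …, N digits of a coincide;
-- cutting out the digits in between gives a smaller witness.  Hence there is a
-- witness below p^N ≤ n_φ.

open import Defs
open import Data.Bool using (Bool; true; false; T; T?)
open import Data.Empty using (⊥; ⊥-elim)
open import Data.Fin as Fin using (Fin; toℕ; fromℕ<; combine; remQuot)
open import Data.Fin.Properties using (toℕ<n; toℕ≤pred[n]; toℕ-fromℕ<; toℕ-injective; toℕ-combine; combine-remQuot; any?; pigeonhole; 1↔⊤; 2↔Bool; +↔⊎; *↔×)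
open import Data.List using (List; []; _∷_; _++_; length; take; drop; foldl; foldr)
open import Data.List.Properties using (foldl-++; foldr-++; ++-assoc; take++drop≡id; take-take; length-take; length-drop)
open import Data.Nat using (>-nonZero; ℕ; zero; suc; pred; _+_; _*_; _^_; _∸_; _⊔_; _⊓_; _≤_; _<_; _≤′_; ≤′-refl; ≤′-step; _≟_; _<?_; z≤n; s≤s; z<s)
open import Data.Nat.DivMod using (_/_; _mod_; _divMod_; DivMod; [m+kn]%n≡m%n; m<n⇒m%n≡m; _%_)
open import Data.Nat.Divisibility using (_∣_; m∣m*n; ∣m+n∣m⇒∣n; *-monoʳ-∣; *-cancelˡ-∣; ∣⇒≤; ∣-trans; divides)
open import Data.Nat.Induction using (<-wellFounded)
open import Data.Nat.Properties
open import Data.Nat.Tactic.RingSolver using (solve-∀)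
open import Data.Product using (∃; ∃₂; _×_; _,_; proj₁; proj₂; uncurry)
open import Data.Product.Function.NonDependent.Propositional using (_×-⇔_; _×-↪_)
open import Data.Sum using (_⊎_; inj₁; inj₂)
open import Data.Sum.Function.Propositional using (_⊎-⇔_; _⊎-↪_)
open import Data.Unit using (⊤; tt)
open import Data.Vec using (Vec; []; _∷_; lookup; tabulate)
open import Data.Vec.Properties using (lookup∘tabulate)
open import Function using (_∘_)
open import Function.Bundles using (_⇔_; mk⇔; Equivalence; _↪_; mk↪; RightInverse)
open import Function.Construct.Composition using (_↪-∘_)
open import Function.Construct.Identity using (↪-id)
open import Function.Properties.Equivalence using () renaming (refl to ⇔-refl; sym to ⇔-sym; trans to ⇔-trans)
open import Function.Properties.Inverse using (↔-sym; ↔⇒↪)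
open import Function.Related.Propositional using (module EquationalReasoning)
open import Function.Related.TypeIsomorphisms using (¬-cong-⇔; →-cong-⇔)
open import Induction.WellFounded using (Acc; acc)
open import Relation.Binary.Definitions using (tri<; tri≈; tri>)
open import Relation.Binary.PropositionalEquality
open import Relation.Nullary using (¬_; yes; no; _×-dec_)
open import Relation.Nullary.Decidable using (isYes; toWitness; fromWitness)
open import Relation.Unary using (Pred; Decidable)
open import Level using (0ℓ)

open Equivalence using (to; from)

update-same : ∀ (ρ : Assignment) x a → (ρ [ x ↦ a ]) x ≡ a
update-same ρ x a with x ≟ x
... | yes _  = refl
... | no x≢x = ⊥-elim (x≢x refl)

update-other : ∀ (ρ : Assignment) {x y} a → y ≢ x → (ρ [ x ↦ a ]) y ≡ ρ y
update-other ρ {x} {y} a y≢x with y ≟ x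
... | yes y≡x = ⊥-elim (y≢x y≡x)
... | no _    = refl

update-cong : ∀ {ρ ρ′ : Assignment} x a → ρ ≗ ρ′ → ρ [ x ↦ a ] ≗ ρ′ [ x ↦ a ]
update-cong x a ρ≗ρ′ y with y ≟ x
... | yes _ = refl
... | no _  = ρ≗ρ′ y

update-agree : ∀ {ρ ρ′ : Assignment} {P : ℕ → Set} x a → (∀ y → y ≢ x × P y → ρ y ≡ ρ′ y) →
               ∀ y → P y → (ρ [ x ↦ a ]) y ≡ (ρ′ [ x ↦ a ]) y
update-agree x a agree y Py with y ≟ x
... | yes _   = refl
... | no y≢x  = agree y (y≢x , Py)

single : ℕ → ℕ → Assignment
single x a = (λ _ → 0) [ x ↦ a ]

module _ (v : ℕ → ℕ) where

  evalT-cong : ∀ t {ρ ρ′} → (∀ y → OccT y t → ρ y ≡ ρ′ y) → evalT v ρ t ≡ evalT v ρ′ t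
  evalT-cong (var x) agree = agree x refl
  evalT-cong 𝟎       agree = refl
  evalT-cong (S t)   agree = cong suc (evalT-cong t agree)
  evalT-cong (t ⊕ u) agree =
    cong₂ _+_ (evalT-cong t (λ y → agree y ∘ inj₁)) (evalT-cong u (λ y → agree y ∘ inj₂))
  evalT-cong (V t)   agree = cong v (evalT-cong t agree)

  Sat-cong : ∀ φ {ρ ρ′} → (∀ y → Free y φ → ρ y ≡ ρ′ y) → Sat v ρ φ → Sat v ρ′ φ
  Sat-cong (t ≐ u) agree h =
    trans (sym (evalT-cong t (λ y → agree y ∘ inj₁))) (trans h (evalT-cong u (λ y → agree y ∘ inj₂)))
  Sat-cong (¬' φ)   agree h = h ∘ Sat-cong φ (λ y → sym ∘ agree y)
  Sat-cong (φ ∧' ψ) agree (hφ , hψ) =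
    Sat-cong φ (λ y → agree y ∘ inj₁) hφ , Sat-cong ψ (λ y → agree y ∘ inj₂) hψ
  Sat-cong (φ ∨' ψ) agree (inj₁ hφ) = inj₁ (Sat-cong φ (λ y → agree y ∘ inj₁) hφ)
  Sat-cong (φ ∨' ψ) agree (inj₂ hψ) = inj₂ (Sat-cong ψ (λ y → agree y ∘ inj₂) hψ)
  Sat-cong (φ ⇒ ψ)  agree h =
    Sat-cong ψ (λ y → agree y ∘ inj₂) ∘ h ∘ Sat-cong φ (λ y → sym ∘ agree y ∘ inj₁)
  Sat-cong (∃' x φ) agree (a , h) = a , Sat-cong φ (update-agree x a agree) h
  Sat-cong (∀' x φ) agree h a = Sat-cong φ (update-agree x a agree) (h a)

  Sat-exactlyFree : ∀ {x} φ → ExactlyFree x φ →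
                    ∀ {ρ ρ′ a} → Sat v (ρ [ x ↦ a ]) φ → Sat v (ρ′ [ x ↦ a ]) φ
  Sat-exactlyFree {x} φ (_ , onlyX) {ρ} {ρ′} {a} = Sat-cong φ agree
    where
    agree : ∀ y → Free y φ → (ρ [ x ↦ a ]) y ≡ (ρ′ [ x ↦ a ]) y
    agree y fy with onlyX y fy
    ... | refl = trans (update-same ρ x a) (sym (update-same ρ′ x a))

  evalT-num : ∀ ρ n → evalT v ρ (num n) ≡ n
  evalT-num ρ zero    = refl
  evalT-num ρ (suc n) = cong suc (evalT-num ρ n)

  evalT-times : ∀ ρ n t → evalT v ρ (times n t) ≡ n * evalT v ρ t
  evalT-times ρ zero          t = refl
  evalT-times ρ (suc zero)    t = sym (+-identityʳ _)
  evalT-times ρ (suc (suc n)) t = trans (cong (_+ evalT v ρ t) (evalT-times ρ (suc n) t)) (+-comm _ (evalT v ρ t))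

  Sat-bigAnd : ∀ {ρ} k f → (∀ i → 1 ≤ i → i ≤ suc k → Sat v ρ (f i)) → Sat v ρ (bigAnd k f)
  Sat-bigAnd zero    f h = h 1 ≤-refl ≤-refl
  Sat-bigAnd (suc k) f h =
    Sat-bigAnd k f (λ i 1≤i i≤1+k → h i 1≤i (m≤n⇒m≤1+n i≤1+k)) , h (2 + k) (s≤s z≤n) ≤-refl

  boundedEx-intro : ∀ {ρ x b n} φ → b ≤ n → Sat v (ρ [ x ↦ b ]) φ → Sat v ρ (boundedEx x (num n) φ)
  boundedEx-intro {ρ} {x} {b} {n} φ b≤n h = b , (n ∸ b , b+[n∸b]≡n) , h
    where
    z  = suc (x ⊔ maxVarT (num n) ⊔ maxVar φ)
    ρ′ = (ρ [ x ↦ b ]) [ z ↦ n ∸ b ]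
    x≢z : x ≢ z
    x≢z x≡z = <-irrefl x≡z (s≤s (≤-trans (m≤m⊔n x _) (m≤m⊔n _ (maxVar φ))))
    b+[n∸b]≡n : ρ′ x + ρ′ z ≡ evalT v ρ′ (num n)
    b+[n∸b]≡n = begin
      ρ′ x + ρ′ z
        ≡⟨ cong₂ _+_ (trans (update-other _ (n ∸ b) x≢z) (update-same ρ x b)) (update-same _ z (n ∸ b)) ⟩
      b + (n ∸ b)  ≡⟨ m+[n∸m]≡n b≤n ⟩
      n            ≡⟨ evalT-num ρ′ n ⟨
      evalT v ρ′ (num n) ∎
      where open ≡-Reasoning

^-monoʳ-∣ : ∀ p {m n} → m ≤ n → p ^ m ∣ p ^ n
^-monoʳ-∣ p {m} {n} m≤n = divides (p ^ (n ∸ m)) (begin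
  p ^ n                ≡⟨ cong (p ^_) (m+[n∸m]≡n m≤n) ⟨
  p ^ (m + (n ∸ m))    ≡⟨ ^-distribˡ-+-* p m (n ∸ m) ⟩
  p ^ m * p ^ (n ∸ m)  ≡⟨ *-comm (p ^ m) _ ⟩
  p ^ (n ∸ m) * p ^ m  ∎)
  where open ≡-Reasoning

exact-power-unique : ∀ p {N a b} → p ^ a ∣ N → ¬ (p ^ suc a ∣ N) → p ^ b ∣ N → ¬ (p ^ suc b ∣ N) → a ≡ b
exact-power-unique p {a = a} {b} pᵃ∣N pᵃ⁺¹∤N pᵇ∣N pᵇ⁺¹∤N with <-cmp a b
... | tri< a<b _ _ = ⊥-elim (pᵃ⁺¹∤N (∣-trans (^-monoʳ-∣ p a<b) pᵇ∣N))
... | tri≈ _ a≡b _ = a≡b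
... | tri> _ _ b<a = ⊥-elim (pᵇ⁺¹∤N (∣-trans (^-monoʳ-∣ p b<a) pᵃ∣N))

module Valuation {q : ℕ} (v : ℕ → ℕ) (isVp : IsVp (2 + q) v) where
  private
    p = 2 + q

  v-unit : ∀ a X → 0 < a → a < p → v (a + p * X) ≡ 1
  v-unit (suc a) X _ a<p with proj₂ isVp (a + p * X)
  ... | zero  , v≡1 , _ , _ = v≡1
  ... | suc k , _ , pᵏ⁺¹∣ , _ = ⊥-elim (<⇒≱ a<p (∣⇒≤ p∣1+a))
    where
    p∣1+a : p ∣ suc a
    p∣1+a = ∣m+n∣m⇒∣n (subst (p ∣_) (+-comm (suc a) (p * X)) (∣-trans (m∣m*n (p ^ k)) pᵏ⁺¹∣))
                      (m∣m*n X)

  v-mul : ∀ X → v (p * X) ≡ p * v X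
  v-mul zero = begin
    v (p * 0)  ≡⟨ cong v (*-zeroʳ p) ⟩
    v 0        ≡⟨ proj₁ isVp ⟩
    0          ≡⟨ *-zeroʳ p ⟨
    p * 0      ≡⟨ cong (p *_) (proj₁ isVp) ⟨
    p * v 0    ∎
    where open ≡-Reasoning
  v-mul (suc n) with proj₂ isVp n | proj₂ isVp (pred (p * suc n))
  ... | j , vN≡pʲ , pʲ∣N , pʲ⁺¹∤N | k , vpN≡pᵏ , pᵏ∣pN , pᵏ⁺¹∤pN =
    trans vpN≡pᵏ (trans (cong (p ^_) k≡1+j) (cong (p *_) (sym vN≡pʲ)))
    where
    k≡1+j : k ≡ suc j
    k≡1+j = exact-power-unique p pᵏ∣pN pᵏ⁺¹∤pN (*-monoʳ-∣ p pʲ∣N) (pʲ⁺¹∤N ∘ *-cancelˡ-∣ p)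

n<2^n : ∀ n → n < 2 ^ n
n<2^n zero    = s≤s z≤n
n<2^n (suc n) = +-mono-≤ (m^n>0 2 n) (subst (suc n ≤_) (sym (+-identityʳ (2 ^ n))) (n<2^n n))

m+m≤2^m : ∀ m → 0 < m → m + m ≤ 2 ^ m
m+m≤2^m (suc k) _ = +-mono-≤ (n<2^n k) (subst (suc k ≤_) (sym (+-identityʳ (2 ^ k))) (n<2^n k))

1+m≤2*m : ∀ {m} → 0 < m → suc m ≤ 2 * m
1+m≤2*m {m} 0<m = +-mono-≤ 0<m (≤-reflexive (sym (+-identityʳ m)))

m≤2^n⇒m*2≤2^1+n : ∀ {m} n → m ≤ 2 ^ n → m * 2 ≤ 2 ^ suc n
m≤2^n⇒m*2≤2^1+n n m≤2^n = ≤-trans (*-monoˡ-≤ 2 m≤2^n) (≤-reflexive (*-comm (2 ^ n) 2))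

tower-step : ∀ k n → tower k n ≤ tower k (suc n)
tower-step k n = <⇒≤ (n<2^n (tower k n))

tower-monoʳ-≤ : ∀ k {m n} → m ≤ n → tower k m ≤ tower k n
tower-monoʳ-≤ k m≤n = go (≤⇒≤′ m≤n)
  where
  go : ∀ {m n} → m ≤′ n → tower k m ≤ tower k n
  go ≤′-refl                 = ≤-refl
  go {n = suc n} (≤′-step m≤n) = ≤-trans (go m≤n) (tower-step k n)

tower-monoˡ-≤ : ∀ {k k′} n → k ≤ k′ → tower k n ≤ tower k′ n
tower-monoˡ-≤ zero    k≤k′ = k≤k′
tower-monoˡ-≤ (suc n) k≤k′ = ^-monoʳ-≤ 2 (tower-monoˡ-≤ n k≤k′)

n<tower : ∀ n → n < tower 1 n
n<tower zero    = s≤s z≤n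
n<tower (suc n) = <-≤-trans (s≤s (n<tower n)) (n<2^n (tower 1 n))

2^n≤tower : ∀ n → 2 ^ n ≤ tower 1 n
2^n≤tower zero    = ≤-refl
2^n≤tower (suc n) = ^-monoʳ-≤ 2 (n<tower n)

tower-square : ∀ n → tower 1 n * tower 1 n ≤ tower 1 (suc n)
tower-square zero    = s≤s z≤n
tower-square (suc n) = subst (_≤ 2 ^ 2 ^ t) (^-distribˡ-+-* 2 t t) (^-monoʳ-≤ 2 (m+m≤2^m t 0<t))
  where
  t = tower 1 n
  0<t : 0 < t
  0<t = <-≤-trans z<s (n<tower n)

tower-*-mono : ∀ {a b} m n → a ≤ tower 1 m → b ≤ tower 1 n → a * b ≤ tower 1 (suc (m + n))
tower-*-mono {a} {b} m n a≤ b≤ = begin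
  a * b                             ≤⟨ *-mono-≤ a≤ b≤ ⟩
  tower 1 m * tower 1 n             ≤⟨ *-mono-≤ (tower-monoʳ-≤ 1 (m≤m⊔n m n)) (tower-monoʳ-≤ 1 (m≤n⊔m m n)) ⟩
  tower 1 (m ⊔ n) * tower 1 (m ⊔ n) ≤⟨ tower-square (m ⊔ n) ⟩
  tower 1 (suc (m ⊔ n))             ≤⟨ tower-monoʳ-≤ 1 (s≤s (m⊔n≤m+n m n)) ⟩
  tower 1 (suc (m + n))             ∎
  where open ≤-Reasoning

-- Finite types, as types with a split injection into some Fin n; subsets of Fin n

_×-fin_ : ∀ {A B : Set} {m n} → A ↪ Fin m → B ↪ Fin n → (A × B) ↪ Fin (m * n)
e₁ ×-fin e₂ = ↔⇒↪ (↔-sym *↔×) ↪-∘ (e₁ ×-↪ e₂)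

⊤⊎-fin : ∀ {A : Set} {n} → A ↪ Fin n → (⊤ ⊎ A) ↪ Fin (suc n)
⊤⊎-fin e = ↔⇒↪ (↔-sym +↔⊎) ↪-∘ (↔⇒↪ (↔-sym 1↔⊤) ⊎-↪ e)

Bool-fin : Bool ↪ Fin 2
Bool-fin = ↔⇒↪ (↔-sym 2↔Bool)

Vec-Bool-fin : ∀ n → Vec Bool n ↪ Fin (2 ^ n)
Vec-Bool-fin zero    = mk↪ {to = λ _ → Fin.zero} {from = λ _ → []} λ { {x = []} _ → refl }
Vec-Bool-fin (suc n) = (Bool-fin ×-fin Vec-Bool-fin n) ↪-∘ uncons
  where
  uncons : Vec Bool (suc n) ↪ (Bool × Vec Bool n)
  uncons = mk↪ {to = λ { (b ∷ bs) → b , bs }} {from = uncurry _∷_} λ { {x = b ∷ bs} refl → refl }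

↪-injective : ∀ {A B : Set} (e : A ↪ B) {x y} → RightInverse.to e x ≡ RightInverse.to e y → x ≡ y
↪-injective e {x} {y} eq = trans (sym (decode-encode x)) (trans (cong decode eq) (decode-encode y))
  where open RightInverse e using () renaming (from to decode; strictlyInverseʳ to decode-encode)

_∈_ : ∀ {n} → Fin n → Vec Bool n → Set
i ∈ U = T (lookup U i)

∈-tabulate : ∀ {n} {P : Pred (Fin n) 0ℓ} (P? : Decidable P) i → i ∈ tabulate (isYes ∘ P?) ⇔ P i
∈-tabulate P? i rewrite lookup∘tabulate (isYes ∘ P?) i = mk⇔ (toWitness {a? = P? i}) fromWitness

take-++-drop-take : ∀ {A : Set} {i j} (xs : List A) → i ≤ j → take i xs ++ drop i (take j xs) ≡ take j xs
take-++-drop-take {i = i} {j} xs i≤j = begin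
  take i xs ++ drop i (take j xs)           ≡⟨ cong (λ k → take k xs ++ drop i (take j xs)) (m≤n⇒m⊓n≡m i≤j) ⟨
  take (i ⊓ j) xs ++ drop i (take j xs)     ≡⟨ cong (_++ drop i (take j xs)) (take-take i j xs) ⟨
  take i (take j xs) ++ drop i (take j xs)  ≡⟨ take++drop≡id i (take j xs) ⟩
  take j xs                                 ∎
  where open ≡-Reasoning

length-drop-take : ∀ {A : Set} i {j} (xs : List A) → j ≤ length xs → length (drop i (take j xs)) ≡ j ∸ i
length-drop-take i {j} xs j≤len =
  trans (length-drop i (take j xs)) (cong (_∸ i) (trans (length-take j xs) (m≤n⇒m⊓n≡m j≤len)))

-- Reading assignments digit by digit in base p = 2 + q

module BaseP (q : ℕ) where

  p : ℕ
  p = 2 + q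

  Digits : Set
  Digits = ℕ → Fin p

  infixl 6 _⊞_
  _⊞_ : Digits → Assignment → Assignment
  (d ⊞ ρ) x = toℕ (d x) + p * ρ x

  _[_≔_] : Digits → ℕ → Fin p → Digits
  (d [ x ≔ e ]) y with y ≟ x
  ... | yes _ = e
  ... | no _  = d y

  ⊞-update : ∀ d x e ρ y → d [ x ≔ e ] ⊞ ρ [ x ↦ y ] ≗ (d ⊞ ρ) [ x ↦ toℕ e + p * y ]
  ⊞-update d x e ρ y z with z ≟ x
  ... | yes _ = refl
  ... | no _  = refl

  digitAt : ℕ → Fin p → Digits
  digitAt x e = (λ _ → Fin.zero) [ x ≔ e ]

  ⊞-single : ∀ x e a → digitAt x e ⊞ single x a ≗ single x (toℕ e + p * a)
  ⊞-single x e a y = trans (⊞-update _ x e _ a y) (update-cong x _ (λ _ → *-zeroʳ p) y)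

  digit-split : ∀ a → a ≡ toℕ (a mod p) + p * (a / p)
  digit-split a = trans (DivMod.property (a divMod p)) (cong (toℕ (a mod p) +_) (*-comm (a / p) p))

  digit-injective : ∀ (a b : Fin p) X Y → toℕ a + p * X ≡ toℕ b + p * Y → a ≡ b × X ≡ Y
  digit-injective a b X Y eq =
    a≡b , *-cancelˡ-≡ X Y p (+-cancelˡ-≡ (toℕ a) _ _ (trans eq (cong (λ c → toℕ c + p * Y) (sym a≡b))))
    where
    low-digit : ∀ (c : Fin p) Z → (toℕ c + p * Z) % p ≡ toℕ c
    low-digit c Z = begin
      (toℕ c + p * Z) % p  ≡⟨ cong (λ w → (toℕ c + w) % p) (*-comm p Z) ⟩
      (toℕ c + Z * p) % p  ≡⟨ [m+kn]%n≡m%n (toℕ c) Z p ⟩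
      toℕ c % p            ≡⟨ m<n⇒m%n≡m (toℕ<n c) ⟩
      toℕ c                ∎
      where open ≡-Reasoning
    a≡b : a ≡ b
    a≡b = toℕ-injective (trans (sym (low-digit a X)) (trans (cong (_% p) eq) (low-digit b Y)))

  digitSum< : ∀ (a b : Fin p) (c : Fin 2) → toℕ a + toℕ b + toℕ c < 2 * p
  digitSum< a b c = begin-strict
    toℕ a + toℕ b + toℕ c    ≡⟨ +-assoc (toℕ a) _ _ ⟩
    toℕ a + (toℕ b + toℕ c)  <⟨ +-mono-<-≤ (toℕ<n a) b+c≤p ⟩
    p + p                    ≡⟨ cong (p +_) (+-identityʳ p) ⟨
    2 * p                    ∎
    where
    open ≤-Reasoning
    b+c≤p : toℕ b + toℕ c ≤ p
    b+c≤p = ≤-trans (+-monoʳ-≤ (toℕ b) (toℕ≤pred[n] c)) (subst (_≤ p) (+-comm 1 (toℕ b)) (toℕ<n b))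

  addDigits : Fin p → Fin p → Fin 2 → Fin 2 × Fin p
  addDigits a b c = remQuot p (fromℕ< (digitSum< a b c))

  addDigits-correct : ∀ a b c X Y → let (c′ , e) = addDigits a b c in
    (toℕ a + p * X) + (toℕ b + p * Y) + toℕ c ≡ toℕ e + p * (X + Y + toℕ c′)
  addDigits-correct a b c X Y = begin
    (toℕ a + p * X) + (toℕ b + p * Y) + toℕ c  ≡⟨ regroup₁ (toℕ a) (toℕ b) (toℕ c) p X Y ⟩
    (toℕ a + toℕ b + toℕ c) + p * (X + Y)      ≡⟨ cong (_+ p * (X + Y)) digitSum≡ ⟩
    (toℕ e + p * toℕ c′) + p * (X + Y)         ≡⟨ regroup₂ (toℕ e) (toℕ c′) p X Y ⟩
    toℕ e + p * (X + Y + toℕ c′)               ∎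
    where
    open ≡-Reasoning
    sum = fromℕ< (digitSum< a b c)
    c′ = proj₁ (addDigits a b c)
    e  = proj₂ (addDigits a b c)

    digitSum≡ : toℕ a + toℕ b + toℕ c ≡ toℕ e + p * toℕ c′
    digitSum≡ = begin
      toℕ a + toℕ b + toℕ c  ≡⟨ toℕ-fromℕ< (digitSum< a b c) ⟨
      toℕ sum                ≡⟨ cong toℕ (combine-remQuot {2} p sum) ⟨
      toℕ (combine c′ e)     ≡⟨ toℕ-combine c′ e ⟩
      p * toℕ c′ + toℕ e     ≡⟨ +-comm (p * toℕ c′) (toℕ e) ⟩
      toℕ e + p * toℕ c′     ∎

    regroup₁ : ∀ a b c p X Y → (a + p * X) + (b + p * Y) + c ≡ (a + b + c) + p * (X + Y)
    regroup₁ = solve-∀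
    regroup₂ : ∀ e c′ p X Y → (e + p * c′) + p * (X + Y) ≡ e + p * (X + Y + c′)
    regroup₂ = solve-∀

  withDigits : List (Fin p) → ℕ → ℕ
  withDigits es y = foldr (λ e z → toℕ e + p * z) y es

  withDigits-++ : ∀ es fs y → withDigits (es ++ fs) y ≡ withDigits es (withDigits fs y)
  withDigits-++ es fs y = foldr-++ (λ e z → toℕ e + p * z) y es fs

  withDigits-split : ∀ n a → ∃₂ λ es y → length es ≡ n × a ≡ withDigits es y
  withDigits-split zero    a = [] , a , refl , refl
  withDigits-split (suc n) a with withDigits-split n (a / p)
  ... | es , y , length-es , a/p≡ =
    a mod p ∷ es , y , cong suc length-es , trans (digit-split a) (cong (λ z → toℕ (a mod p) + p * z) a/p≡)

  withDigits-0<pow : ∀ es → withDigits es 0 < p ^ length es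
  withDigits-0<pow []       = s≤s z≤n
  withDigits-0<pow (e ∷ es) = begin-strict
    toℕ e + p * withDigits es 0  <⟨ +-monoˡ-< (p * withDigits es 0) (toℕ<n e) ⟩
    p + p * withDigits es 0      ≡⟨ *-suc p (withDigits es 0) ⟨
    p * suc (withDigits es 0)    ≤⟨ *-monoʳ-≤ p (withDigits-0<pow es) ⟩
    p * p ^ length es            ∎
    where open ≤-Reasoning

  withDigits-monoʳ-< : ∀ es {y z} → y < z → withDigits es y < withDigits es z
  withDigits-monoʳ-< []       y<z = y<z
  withDigits-monoʳ-< (e ∷ es) y<z = +-monoʳ-< (toℕ e) (*-monoʳ-< p (withDigits-monoʳ-< es y<z))

  withDigits-inflationary : ∀ es y → y ≤ withDigits es y
  withDigits-inflationary []       y = ≤-refl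
  withDigits-inflationary (e ∷ es) y =
    ≤-trans (withDigits-inflationary es y) (≤-trans (m≤n*m _ p) (m≤n+m _ (toℕ e)))

  withDigits-expanding : ∀ es {y} → 0 < length es → 0 < y → y < withDigits es y
  withDigits-expanding (e ∷ es) {y} _ 0<y = begin-strict
    y                      ≤⟨ withDigits-inflationary es y ⟩
    withDigits es y        <⟨ m<m*n (withDigits es y) p {{>-nonZero 0<w}} (s≤s (s≤s z≤n)) ⟩
    withDigits es y * p    ≡⟨ *-comm (withDigits es y) p ⟩
    p * withDigits es y    ≤⟨ m≤n+m _ (toℕ e) ⟩
    withDigits (e ∷ es) y  ∎
    where
    open ≤-Reasoning
    0<w = <-≤-trans 0<y (withDigits-inflationary es y)

  -- A state s stands for the number value s ρ, where ρ assigns the not yet read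
  -- (higher) parts of the variables; reading their next digits d emits the
  -- lowest digit of that number and moves to the state for the rest of it.
  record Transducer (n : ℕ) (f : Assignment → ℕ) : Set₁ where
    field
      State       : Set
      encoding    : State ↪ Fin n
      value       : State → Assignment → ℕ
      value-cong  : ∀ s {ρ ρ′} → ρ ≗ ρ′ → value s ρ ≡ value s ρ′
      step        : State → Digits → Fin p × State
      value-step  : ∀ s d ρ → value s (d ⊞ ρ) ≡ toℕ (proj₁ (step s d)) + p * value (proj₂ (step s d)) ρ
      start       : State
      value-start : ∀ ρ → value start ρ ≡ f ρ

  retarget : ∀ {n f g} → f ≗ g → Transducer n f → Transducer n g
  retarget f≗g T = record
    { State = State ; encoding = encoding ; value = value ; value-cong = value-cong
    ; step = step ; value-step = value-step
    ; start = start ; value-start = λ ρ → trans (value-start ρ) (f≗g ρ) }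
    where open Transducer T

  variableT : ∀ x → Transducer 1 (λ ρ → ρ x)
  variableT x = record
    { State = ⊤ ; encoding = ↔⇒↪ (↔-sym 1↔⊤)
    ; value = λ _ ρ → ρ x ; value-cong = λ _ ρ≗ρ′ → ρ≗ρ′ x
    ; step = λ _ d → d x , tt ; value-step = λ _ _ _ → refl
    ; start = tt ; value-start = λ _ → refl }

  zeroT : Transducer 1 (λ _ → 0)
  zeroT = record
    { State = ⊤ ; encoding = ↔⇒↪ (↔-sym 1↔⊤)
    ; value = λ _ _ → 0 ; value-cong = λ _ _ → refl
    ; step = λ _ _ → Fin.zero , tt ; value-step = λ _ _ _ → sym (*-zeroʳ p)
    ; start = tt ; value-start = λ _ → refl }

  addT : ∀ {m n f g} → Transducer m f → Transducer n g → (c : Fin 2) →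
         Transducer (m * (n * 2)) (λ ρ → f ρ + g ρ + toℕ c)
  addT T U c₀ = record
    { State = T.State × U.State × Fin 2
    ; encoding = T.encoding ×-fin (U.encoding ×-fin ↪-id (Fin 2))
    ; value = value ; value-cong = value-cong
    ; step = step ; value-step = value-step
    ; start = T.start , U.start , c₀
    ; value-start = λ ρ → cong₂ (λ a b → a + b + toℕ c₀) (T.value-start ρ) (U.value-start ρ) }
    where
    module T = Transducer T
    module U = Transducer U

    value : T.State × U.State × Fin 2 → Assignment → ℕ
    value (s , t , c) ρ = T.value s ρ + U.value t ρ + toℕ c

    value-cong : ∀ st {ρ ρ′} → ρ ≗ ρ′ → value st ρ ≡ value st ρ′
    value-cong (s , t , c) ρ≗ρ′ =
      cong₂ (λ a b → a + b + toℕ c) (T.value-cong s ρ≗ρ′) (U.value-cong t ρ≗ρ′)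

    carryDigit : T.State → U.State → Fin 2 → Digits → Fin 2 × Fin p
    carryDigit s t c d = addDigits (proj₁ (T.step s d)) (proj₁ (U.step t d)) c

    step : T.State × U.State × Fin 2 → Digits → Fin p × (T.State × U.State × Fin 2)
    step (s , t , c) d =
      proj₂ (carryDigit s t c d) , proj₂ (T.step s d) , proj₂ (U.step t d) , proj₁ (carryDigit s t c d)

    value-step : ∀ st d ρ → value st (d ⊞ ρ) ≡ toℕ (proj₁ (step st d)) + p * value (proj₂ (step st d)) ρ
    value-step (s , t , c) d ρ = begin
      T.value s (d ⊞ ρ) + U.value t (d ⊞ ρ) + toℕ c
        ≡⟨ cong₂ (λ x y → x + y + toℕ c) (T.value-step s d ρ) (U.value-step t d ρ) ⟩
      (toℕ a + p * X) + (toℕ b + p * Y) + toℕ c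
        ≡⟨ addDigits-correct a b c X Y ⟩
      toℕ (proj₂ (addDigits a b c)) + p * (X + Y + toℕ (proj₁ (addDigits a b c))) ∎
      where
      open ≡-Reasoning
      a = proj₁ (T.step s d)
      b = proj₁ (U.step t d)
      X = T.value (proj₂ (T.step s d)) ρ
      Y = U.value (proj₂ (U.step t d)) ρ

  -- Likewise, a state s of an automaton stands for the property Holds s of the
  -- remaining parts of the variables.
  record Automaton (n : ℕ) (R : Assignment → Set) : Set₁ where
    field
      State       : Set
      encoding    : State ↪ Fin n
      Holds       : State → Assignment → Set
      Holds-cong  : ∀ s {ρ ρ′} → ρ ≗ ρ′ → Holds s ρ → Holds s ρ′
      next        : State → Digits → State
      Holds-next  : ∀ s d ρ → Holds (next s d) ρ ⇔ Holds s (d ⊞ ρ)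
      start       : State
      Holds-start : ∀ ρ → R ρ ⇔ Holds start ρ

    Holds-cong-⇔ : ∀ s {ρ ρ′} → ρ ≗ ρ′ → Holds s ρ ⇔ Holds s ρ′
    Holds-cong-⇔ s ρ≗ρ′ = mk⇔ (Holds-cong s ρ≗ρ′) (Holds-cong s (sym ∘ ρ≗ρ′))

  equalityA : ∀ {m n f g} → Transducer m f → Transducer n g → Automaton (suc (m * n)) (λ ρ → f ρ ≡ g ρ)
  equalityA T U = record
    { State = State ; encoding = ⊤⊎-fin (T.encoding ×-fin U.encoding)
    ; Holds = Holds ; Holds-cong = Holds-cong
    ; next = next ; Holds-next = Holds-next
    ; start = inj₂ (T.start , U.start)
    ; Holds-start = λ ρ → ≡-⇔ (sym (T.value-start ρ)) (sym (U.value-start ρ)) }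
    where
    module T = Transducer T
    module U = Transducer U

    ≡-⇔ : ∀ {a a′ b b′ : ℕ} → a ≡ a′ → b ≡ b′ → (a ≡ b) ⇔ (a′ ≡ b′)
    ≡-⇔ refl refl = ⇔-refl

    State : Set
    State = ⊤ ⊎ (T.State × U.State)

    Holds : State → Assignment → Set
    Holds (inj₁ _)       ρ = ⊥
    Holds (inj₂ (s , t)) ρ = T.value s ρ ≡ U.value t ρ

    Holds-cong : ∀ st {ρ ρ′} → ρ ≗ ρ′ → Holds st ρ → Holds st ρ′
    Holds-cong (inj₂ (s , t)) ρ≗ρ′ h = trans (sym (T.value-cong s ρ≗ρ′)) (trans h (U.value-cong t ρ≗ρ′))

    compareDigits : Fin p × T.State → Fin p × U.State → State
    compareDigits (a , s) (b , t) with a Fin.≟ b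
    ... | yes _ = inj₂ (s , t)
    ... | no _  = inj₁ tt

    Holds-compareDigits : ∀ a s b t ρ →
      Holds (compareDigits (a , s) (b , t)) ρ ⇔ (toℕ a + p * T.value s ρ ≡ toℕ b + p * U.value t ρ)
    Holds-compareDigits a s b t ρ with a Fin.≟ b
    ... | yes refl = mk⇔ (cong (λ X → toℕ a + p * X)) (proj₂ ∘ digit-injective a a (T.value s ρ) (U.value t ρ))
    ... | no a≢b   = mk⇔ ⊥-elim (a≢b ∘ proj₁ ∘ digit-injective a b (T.value s ρ) (U.value t ρ))

    next : State → Digits → State
    next (inj₁ _)       d = inj₁ tt
    next (inj₂ (s , t)) d = compareDigits (T.step s d) (U.step t d)

    Holds-next : ∀ st d ρ → Holds (next st d) ρ ⇔ Holds st (d ⊞ ρ)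
    Holds-next (inj₁ _)       d ρ = ⇔-refl
    Holds-next (inj₂ (s , t)) d ρ =
      ⇔-trans (Holds-compareDigits _ _ _ _ ρ) (≡-⇔ (sym (T.value-step s d ρ)) (sym (U.value-step t d ρ)))

  mapA : ∀ {n R} (F : Set → Set) → (∀ {A B} → A ⇔ B → F A ⇔ F B) → Automaton n R → Automaton n (F ∘ R)
  mapA F F-cong A = record
    { State = State ; encoding = encoding
    ; Holds = λ s ρ → F (Holds s ρ) ; Holds-cong = λ s ρ≗ρ′ → to (F-cong (Holds-cong-⇔ s ρ≗ρ′))
    ; next = next ; Holds-next = λ s d ρ → F-cong (Holds-next s d ρ)
    ; start = start ; Holds-start = λ ρ → F-cong (Holds-start ρ) }
    where open Automaton A

  zipA : ∀ {m n R₁ R₂} (F : Set → Set → Set) →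
         (∀ {A A′ B B′} → A ⇔ A′ → B ⇔ B′ → F A B ⇔ F A′ B′) →
         Automaton m R₁ → Automaton n R₂ → Automaton (m * n) (λ ρ → F (R₁ ρ) (R₂ ρ))
  zipA F F-cong A B = record
    { State = A.State × B.State ; encoding = A.encoding ×-fin B.encoding
    ; Holds = λ (s , t) ρ → F (A.Holds s ρ) (B.Holds t ρ)
    ; Holds-cong = λ (s , t) ρ≗ρ′ → to (F-cong (A.Holds-cong-⇔ s ρ≗ρ′) (B.Holds-cong-⇔ t ρ≗ρ′))
    ; next = λ (s , t) d → A.next s d , B.next t d
    ; Holds-next = λ (s , t) d ρ → F-cong (A.Holds-next s d ρ) (B.Holds-next t d ρ)
    ; start = A.start , B.start
    ; Holds-start = λ ρ → F-cong (A.Holds-start ρ) (B.Holds-start ρ) }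
    where
    module A = Automaton A
    module B = Automaton B

  -- Subset construction: a state is a set U of (codes of) states of A, standing
  -- for "some (every) i ∈ U holds for some (every) value of x"; a step follows
  -- every possible digit of x.
  module Projection {n R} (A : Automaton n R) (x : ℕ) where
    open Automaton A
    open RightInverse encoding using () renaming (to to encode; from to decode; strictlyInverseʳ to decode-encode)

    Successor : Vec Bool n → Digits → Fin n → Set
    Successor U d j = ∃₂ λ i e → i ∈ U × encode (next (decode i) (d [ x ≔ e ])) ≡ j

    successor? : ∀ U d → Decidable (Successor U d)
    successor? U d j =
      any? λ i → any? λ e → T? (lookup U i) ×-dec (encode (next (decode i) (d [ x ≔ e ])) Fin.≟ j)

    successors : Vec Bool n → Digits → Vec Bool n
    successors U d = tabulate (isYes ∘ successor? U d)

    ∈-successors : ∀ U d j → j ∈ successors U d ⇔ Successor U d j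
    ∈-successors U d = ∈-tabulate (successor? U d)

    initial : Vec Bool n
    initial = tabulate (isYes ∘ (Fin._≟ encode start))

    ∈-initial : ∀ j → j ∈ initial ⇔ j ≡ encode start
    ∈-initial = ∈-tabulate (Fin._≟ encode start)

    Holds-decode : ∀ {s j ρ} → encode s ≡ j → Holds (decode j) ρ ⇔ Holds s ρ
    Holds-decode {s} refl rewrite decode-encode s = ⇔-refl

    Holds-successor : ∀ d i e {j} ρ y → encode (next (decode i) (d [ x ≔ e ])) ≡ j →
                      Holds (decode j) (ρ [ x ↦ y ]) ⇔ Holds (decode i) ((d ⊞ ρ) [ x ↦ toℕ e + p * y ])
    Holds-successor d i e ρ y eq =
      ⇔-trans (Holds-decode eq) (⇔-trans (Holds-next _ _ _) (Holds-cong-⇔ (decode i) (⊞-update d x e ρ y)))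

    Holds-digit-split : ∀ s ρ Y → Holds s (ρ [ x ↦ Y ]) ⇔ Holds s (ρ [ x ↦ toℕ (Y mod p) + p * (Y / p) ])
    Holds-digit-split s ρ Y rewrite sym (digit-split Y) = ⇔-refl

    Some : Vec Bool n → Assignment → Set
    Some U ρ = ∃₂ λ i y → i ∈ U × Holds (decode i) (ρ [ x ↦ y ])

    Some-next : ∀ U d ρ → Some (successors U d) ρ ⇔ Some U (d ⊞ ρ)
    Some-next U d ρ = mk⇔ forward backward
      where
      forward : Some (successors U d) ρ → Some U (d ⊞ ρ)
      forward (j , y , j∈ , h) with to (∈-successors U d j) j∈
      ... | i , e , i∈U , eq = i , toℕ e + p * y , i∈U , to (Holds-successor d i e ρ y eq) h
      backward : Some U (d ⊞ ρ) → Some (successors U d) ρ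
      backward (i , Y , i∈U , h) =
        _ , Y / p , from (∈-successors U d _) (i , Y mod p , i∈U , refl) ,
        from (Holds-successor d i (Y mod p) ρ (Y / p) refl) (to (Holds-digit-split (decode i) (d ⊞ ρ) Y) h)

    Some-initial : ∀ ρ → (∃ λ a → R (ρ [ x ↦ a ])) ⇔ Some initial ρ
    Some-initial ρ = mk⇔
      (λ (a , r) → encode start , a , from (∈-initial _) refl , from (Holds-decode refl) (to (Holds-start _) r))
      (λ (j , y , j∈ , h) → y , from (Holds-start _) (to (Holds-decode (sym (to (∈-initial j) j∈))) h))

    existsA : Automaton (2 ^ n) (λ ρ → ∃ λ a → R (ρ [ x ↦ a ]))
    existsA = record
      { State = Vec Bool n ; encoding = Vec-Bool-fin n
      ; Holds = Some
      ; Holds-cong = λ U ρ≗ρ′ (i , y , i∈U , h) →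
          i , y , i∈U , Holds-cong (decode i) (update-cong x y ρ≗ρ′) h
      ; next = successors ; Holds-next = Some-next
      ; start = initial ; Holds-start = Some-initial }

    Every : Vec Bool n → Assignment → Set
    Every U ρ = ∀ i → i ∈ U → ∀ y → Holds (decode i) (ρ [ x ↦ y ])

    Every-next : ∀ U d ρ → Every (successors U d) ρ ⇔ Every U (d ⊞ ρ)
    Every-next U d ρ = mk⇔ forward backward
      where
      forward : Every (successors U d) ρ → Every U (d ⊞ ρ)
      forward h i i∈U Y = from (Holds-digit-split (decode i) (d ⊞ ρ) Y)
        (to (Holds-successor d i (Y mod p) ρ (Y / p) refl)
          (h _ (from (∈-successors U d _) (i , Y mod p , i∈U , refl)) (Y / p)))
      backward : Every U (d ⊞ ρ) → Every (successors U d) ρ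
      backward h j j∈ y with to (∈-successors U d j) j∈
      ... | i , e , i∈U , eq = from (Holds-successor d i e ρ y eq) (h i i∈U (toℕ e + p * y))

    Every-initial : ∀ ρ → (∀ a → R (ρ [ x ↦ a ])) ⇔ Every initial ρ
    Every-initial ρ = mk⇔
      (λ r j j∈ y → from (Holds-decode (sym (to (∈-initial j) j∈))) (to (Holds-start _) (r y)))
      (λ h a → from (Holds-start _) (to (Holds-decode refl) (h (encode start) (from (∈-initial _) refl) a)))

    forallA : Automaton (2 ^ n) (λ ρ → ∀ a → R (ρ [ x ↦ a ]))
    forallA = record
      { State = Vec Bool n ; encoding = Vec-Bool-fin n
      ; Holds = Every
      ; Holds-cong = λ U ρ≗ρ′ h i i∈U y → Holds-cong (decode i) (update-cong x y ρ≗ρ′) (h i i∈U y)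
      ; next = successors ; Holds-next = Every-next
      ; start = initial ; Holds-start = Every-initial }

  open Projection using (existsA; forallA)

  module Pumping {n R} (A : Automaton n R) (x : ℕ) where
    open Automaton A
    open RightInverse encoding using () renaming (to to encode)

    run : State → List (Fin p) → State
    run = foldl (λ s e → next s (digitAt x e))

    Holds-run : ∀ s es y → Holds s (single x (withDigits es y)) ⇔ Holds (run s es) (single x y)
    Holds-run s []       y = ⇔-refl
    Holds-run s (e ∷ es) y = begin
      Holds s (single x (toℕ e + p * withDigits es y))       ∼⟨ Holds-cong-⇔ s (sym ∘ ⊞-single x e _) ⟩
      Holds s (digitAt x e ⊞ single x (withDigits es y))     ∼⟨ ⇔-sym (Holds-next s (digitAt x e) _) ⟩
      Holds (next s (digitAt x e)) (single x (withDigits es y)) ∼⟨ Holds-run (next s (digitAt x e)) es y ⟩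
      Holds (run s (e ∷ es)) (single x y)                    ∎
      where open EquationalReasoning

    Holds-cut : ∀ s as bs z → run s as ≡ run s (as ++ bs) →
                Holds s (single x (withDigits as (withDigits bs z))) ⇔ Holds s (single x (withDigits as z))
    Holds-cut s as bs z loops = begin
      Holds s (single x (withDigits as (withDigits bs z)))  ∼⟨ Holds-run s as _ ⟩
      Holds (run s as) (single x (withDigits bs z))         ∼⟨ Holds-run (run s as) bs z ⟩
      Holds (run (run s as) bs) (single x z)                ≡⟨ cong (λ t → Holds t _) (foldl-++ _ s as bs) ⟨
      Holds (run s (as ++ bs)) (single x z)                 ≡⟨ cong (λ t → Holds t _) loops ⟨
      Holds (run s as) (single x z)                         ∼⟨ ⇔-sym (Holds-run s as z) ⟩
      Holds s (single x (withDigits as z))                  ∎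
      where open EquationalReasoning

    record Loop (s : State) (es : List (Fin p)) : Set where
      constructor loop
      field
        prefix cycle suffix : List (Fin p)
        splits   : es ≡ prefix ++ cycle ++ suffix
        nonempty : 0 < length cycle
        returns  : run s prefix ≡ run s (prefix ++ cycle)

    loop-between : ∀ s es {i j} → i < j → j ≤ length es → run s (take i es) ≡ run s (take j es) → Loop s es
    loop-between s es {i} {j} i<j j≤len same =
      loop (take i es) (drop i (take j es)) (drop j es) splits nonempty returns
      where
      prefix++cycle = take-++-drop-take es (<⇒≤ i<j)
      splits = begin
        es                                                ≡⟨ take++drop≡id j es ⟨
        take j es ++ drop j es                            ≡⟨ cong (_++ drop j es) prefix++cycle ⟨
        (take i es ++ drop i (take j es)) ++ drop j es    ≡⟨ ++-assoc (take i es) _ _ ⟩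
        take i es ++ drop i (take j es) ++ drop j es      ∎
        where open ≡-Reasoning
      nonempty = subst (0 <_) (sym (length-drop-take i es j≤len)) (m<n⇒0<n∸m i<j)
      returns = trans same (cong (run s) (sym prefix++cycle))

    loop-exists : ∀ s es → length es ≡ n → Loop s es
    loop-exists s es length≡n with pigeonhole (n<1+n n) (λ i → encode (run s (take (toℕ i) es)))
    ... | i , j , i<j , same =
      loop-between s es i<j (≤-trans (toℕ≤pred[n] j) (≤-reflexive (sym length≡n))) (↪-injective encoding same)

    shorten : ∀ s a → p ^ n ≤ a → Holds s (single x a) → ∃ λ b → b < a × Holds s (single x b)
    shorten s a pⁿ≤a h with withDigits-split n a
    ... | es , y , length≡n , refl with loop-exists s es length≡n
    ... | loop as bs cs refl 0<|bs| loops = withDigits as z , b<a , hb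
      where
      z = withDigits cs y
      a≡ : withDigits (as ++ bs ++ cs) y ≡ withDigits as (withDigits bs z)
      a≡ = trans (withDigits-++ as (bs ++ cs) y) (cong (withDigits as) (withDigits-++ bs cs y))
      0<y : 0 < y
      0<y = n≢0⇒n>0 λ { refl →
        <⇒≱ (withDigits-0<pow (as ++ bs ++ cs)) (subst (λ k → p ^ k ≤ _) (sym length≡n) pⁿ≤a) }
      0<z : 0 < z
      0<z = <-≤-trans 0<y (withDigits-inflationary cs y)
      b<a : withDigits as z < withDigits (as ++ bs ++ cs) y
      b<a = subst (withDigits as z <_) (sym a≡) (withDigits-monoʳ-< as (withDigits-expanding bs 0<|bs| 0<z))
      hb : Holds s (single x (withDigits as z))
      hb = to (Holds-cut s as bs z loops) (subst (λ a → Holds s (single x a)) a≡ h)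

    pumping : ∀ s a → Holds s (single x a) → ∃ λ b → b < p ^ n × Holds s (single x b)
    pumping s a = go a (<-wellFounded a)
      where
      go : ∀ a → Acc _<_ a → Holds s (single x a) → ∃ λ b → b < p ^ n × Holds s (single x b)
      go a (acc smaller) h with a <? p ^ n
      ... | yes a<pⁿ = a , a<pⁿ , h
      ... | no a≮pⁿ  = let b , b<a , hb = shorten s a (≮⇒≥ a≮pⁿ) h in go b (smaller b<a) hb

    small-witness : ∀ {a} → R (single x a) → ∃ λ b → b < p ^ n × R (single x b)
    small-witness r =
      let b , b<pⁿ , hb = pumping start _ (to (Holds-start _) r) in b , b<pⁿ , from (Holds-start _) hb

  module Formulas (v : ℕ → ℕ) (v-mul : ∀ X → v (p * X) ≡ p * v X)
                  (v-unit : ∀ a X → 0 < a → a < p → v (a + p * X) ≡ 1) where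

    -- The flag records that a nonzero digit has been emitted: from then on the
    -- valuation is 1, whose remaining higher part is 0.
    valuationT : ∀ {n f} → Transducer n f → Transducer (n * 2) (v ∘ f)
    valuationT T = record
      { State = T.State × Bool ; encoding = T.encoding ×-fin Bool-fin
      ; value = value ; value-cong = value-cong
      ; step = step ; value-step = value-step
      ; start = T.start , false ; value-start = λ ρ → cong v (T.value-start ρ) }
      where
      module T = Transducer T

      value : T.State × Bool → Assignment → ℕ
      value (s , false) ρ = v (T.value s ρ)
      value (s , true)  ρ = 0

      value-cong : ∀ st {ρ ρ′} → ρ ≗ ρ′ → value st ρ ≡ value st ρ′
      value-cong (s , false) ρ≗ρ′ = cong v (T.value-cong s ρ≗ρ′)
      value-cong (s , true)  ρ≗ρ′ = refl

      emit : Fin p × T.State → Fin p × (T.State × Bool)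
      emit (Fin.zero  , s′) = Fin.zero , s′ , false
      emit (Fin.suc _ , s′) = Fin.suc Fin.zero , s′ , true

      value-emit : ∀ o ρ → v (toℕ (proj₁ o) + p * T.value (proj₂ o) ρ) ≡
                           toℕ (proj₁ (emit o)) + p * value (proj₂ (emit o)) ρ
      value-emit (Fin.zero  , s′) ρ = v-mul (T.value s′ ρ)
      value-emit (Fin.suc a , s′) ρ =
        trans (v-unit (suc (toℕ a)) (T.value s′ ρ) z<s (toℕ<n (Fin.suc a))) (cong suc (sym (*-zeroʳ p)))

      step : T.State × Bool → Digits → Fin p × (T.State × Bool)
      step (s , false) d = emit (T.step s d)
      step (s , true)  d = Fin.zero , s , true

      value-step : ∀ st d ρ → value st (d ⊞ ρ) ≡ toℕ (proj₁ (step st d)) + p * value (proj₂ (step st d)) ρ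
      value-step (s , false) d ρ = trans (cong v (T.value-step s d ρ)) (value-emit (T.step s d) ρ)
      value-step (s , true)  d ρ = sym (*-zeroʳ p)

    termSize : Term → ℕ
    termSize (var _) = 1
    termSize 𝟎       = 1
    termSize (S t)   = termSize t * 2
    termSize (t ⊕ u) = termSize t * (termSize u * 2)
    termSize (V t)   = termSize t * 2

    termT : ∀ t → Transducer (termSize t) (λ ρ → evalT v ρ t)
    termT (var x) = variableT x
    termT 𝟎       = zeroT
    termT (S t)   =
      retarget (λ ρ → trans (+-comm _ 1) (cong suc (+-identityʳ _))) (addT (termT t) zeroT (Fin.suc Fin.zero))
    termT (t ⊕ u) = retarget (λ ρ → +-identityʳ _) (addT (termT t) (termT u) Fin.zero)
    termT (V t)   = valuationT (termT t)

    formulaSize : Formula → ℕ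
    formulaSize (t ≐ u)  = suc (termSize t * termSize u)
    formulaSize (¬' φ)   = formulaSize φ
    formulaSize (φ ∧' ψ) = formulaSize φ * formulaSize ψ
    formulaSize (φ ∨' ψ) = formulaSize φ * formulaSize ψ
    formulaSize (φ ⇒ ψ)  = formulaSize φ * formulaSize ψ
    formulaSize (∃' _ φ) = 2 ^ formulaSize φ
    formulaSize (∀' _ φ) = 2 ^ formulaSize φ

    formulaA : ∀ φ → Automaton (formulaSize φ) (λ ρ → Sat v ρ φ)
    formulaA (t ≐ u)  = equalityA (termT t) (termT u)
    formulaA (¬' φ)   = mapA ¬_ ¬-cong-⇔ (formulaA φ)
    formulaA (φ ∧' ψ) = zipA _×_ _×-⇔_ (formulaA φ) (formulaA ψ)
    formulaA (φ ∨' ψ) = zipA _⊎_ _⊎-⇔_ (formulaA φ) (formulaA ψ)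
    formulaA (φ ⇒ ψ)  = zipA (λ A B → A → B) →-cong-⇔ (formulaA φ) (formulaA ψ)
    formulaA (∃' x φ) = existsA (formulaA φ) x
    formulaA (∀' x φ) = forallA (formulaA φ) x

    termSize≤2^len : ∀ t → termSize t ≤ 2 ^ lenT t
    termSize≤2^len (var _) = s≤s z≤n
    termSize≤2^len 𝟎       = s≤s z≤n
    termSize≤2^len (S t)   = m≤2^n⇒m*2≤2^1+n (lenT t) (termSize≤2^len t)
    termSize≤2^len (t ⊕ u) = begin
      termSize t * (termSize u * 2)
        ≤⟨ *-mono-≤ (termSize≤2^len t) (m≤2^n⇒m*2≤2^1+n (lenT u) (termSize≤2^len u)) ⟩
      2 ^ lenT t * 2 ^ suc (lenT u)        ≡⟨ ^-distribˡ-+-* 2 (lenT t) (suc (lenT u)) ⟨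
      2 ^ (lenT t + suc (lenT u))          ≡⟨ cong (2 ^_) (+-suc (lenT t) (lenT u)) ⟩
      2 ^ suc (lenT t + lenT u)            ∎
      where open ≤-Reasoning
    termSize≤2^len (V t)   = m≤2^n⇒m*2≤2^1+n (lenT t) (termSize≤2^len t)

    formulaSize≤tower : ∀ φ → formulaSize φ ≤ tower 1 (len φ)
    formulaSize≤tower (t ≐ u)  = begin
      suc (termSize t * termSize u)      ≤⟨ s≤s (*-mono-≤ (termSize≤2^len t) (termSize≤2^len u)) ⟩
      suc (2 ^ lenT t * 2 ^ lenT u)      ≡⟨ cong suc (^-distribˡ-+-* 2 (lenT t) (lenT u)) ⟨
      suc (2 ^ (lenT t + lenT u))        ≤⟨ 1+m≤2*m (m^n>0 2 (lenT t + lenT u)) ⟩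
      2 ^ suc (lenT t + lenT u)          ≤⟨ 2^n≤tower (suc (lenT t + lenT u)) ⟩
      tower 1 (suc (lenT t + lenT u))    ∎
      where open ≤-Reasoning
    formulaSize≤tower (¬' φ)   = ≤-trans (formulaSize≤tower φ) (tower-step 1 (len φ))
    formulaSize≤tower (φ ∧' ψ) = tower-*-mono (len φ) (len ψ) (formulaSize≤tower φ) (formulaSize≤tower ψ)
    formulaSize≤tower (φ ∨' ψ) = tower-*-mono (len φ) (len ψ) (formulaSize≤tower φ) (formulaSize≤tower ψ)
    formulaSize≤tower (φ ⇒ ψ)  = tower-*-mono (len φ) (len ψ) (formulaSize≤tower φ) (formulaSize≤tower ψ)
    formulaSize≤tower (∃' _ φ) = ≤-trans (^-monoʳ-≤ 2 (formulaSize≤tower φ)) (tower-step 1 (suc (len φ)))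
    formulaSize≤tower (∀' _ φ) = ≤-trans (^-monoʳ-≤ 2 (formulaSize≤tower φ)) (tower-step 1 (suc (len φ)))

    bounded-witness : ∀ φ x {a} → Sat v (single x a) φ → ∃ λ b → b ≤ nBound p φ × Sat v (single x b) φ
    bounded-witness φ x h = let b , b<pⁿ , hb = Pumping.small-witness (formulaA φ) x h in
      b , <⇒≤ (<-≤-trans b<pⁿ (^-monoʳ-≤ p size≤)) , hb
      where
      size≤ : formulaSize φ ≤ tower 3 (len φ)
      size≤ = ≤-trans (formulaSize≤tower φ) (tower-monoˡ-≤ (len φ) (s≤s z≤n))

module _ {q : ℕ} {v : ℕ → ℕ} (isVp : IsVp (2 + q) v) where
  open BaseP q using (p; module Formulas)
  open Valuation v isVp using (v-mul; v-unit)
  open Formulas v v-mul v-unit using (bounded-witness)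

  Sat-Bound : ∀ φ x → ExactlyFree x φ → ∀ ρ → Sat v ρ (∃' x φ ⇒ boundedEx x (num (nBound p φ)) φ)
  Sat-Bound φ x free ρ (a , φa) =
    let b , b≤n , φb = bounded-witness φ x (Sat-exactlyFree v φ free φa) in
    boundedEx-intro v φ b≤n (Sat-exactlyFree v φ free φb)

  Sat-axiom : ∀ σ → Axiom p σ → ∀ ρ → Sat v ρ σ
  Sat-axiom _ S0 ρ a b = suc-injective
  Sat-axiom _ S1 ρ a ()
  Sat-axiom _ S2 ρ zero    = inj₁ refl
  Sat-axiom _ S2 ρ (suc a) = inj₂ (a , refl)
  Sat-axiom _ A0 ρ a = +-identityʳ a
  Sat-axiom _ A1 ρ a b = +-suc a b
  Sat-axiom _ V0 ρ = proj₁ isVp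
  Sat-axiom _ V1 ρ = trans (cong (v ∘ suc) (sym (*-zeroʳ p))) (v-unit 1 0 z<s (s≤s (s≤s z≤n)))
  Sat-axiom _ V2 ρ a =
    trans (cong v (evalT-times v _ p (var 0))) (trans (v-mul _) (sym (evalT-times v _ p (V (var 0)))))
  Sat-axiom _ V3 ρ a = Sat-bigAnd v q _ λ i 0<i i≤1+q → let ρ′ = ρ [ 0 ↦ a ] in
    trans (cong v (cong₂ _+_ (evalT-times v ρ′ p (var 0)) (evalT-num v ρ′ i)))
          (trans (cong v (+-comm (p * ρ′ 0) i)) (v-unit i (ρ′ 0) 0<i (s≤s i≤1+q)))
  Sat-axiom _ (Bound φ x free) ρ = Sat-Bound φ x free ρ

theorem4 : (p : ℕ) → 2 ≤ p → (v : ℕ → ℕ) → IsVp p v →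
    (σ : Formula) → Axiom p σ → (ρ : Assignment) → Sat v ρ σ
theorem4 (suc (suc q)) (s≤s (s≤s z≤n)) v isVp = Sat-axiom isVp
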